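{- Let $N$ and $k$ be integers with $F_k<N<F_{k+1}$. If $k\equiv 0,2,3,5\pmod 6$, or if $k\equiv 1,4\pmod 6$ and $N<\tfrac{F_{k+2}}{2}$, then $S(N)=S(F_k)+S(N-F_k)$.
   Context: The Fibonacci numbers are defined by $F_0=0$, $F_1=1$ and $F_m=F_{m-1}+F_{m-2}$ for $m\geq 2$. For each integer $n\geq 1$, the Fibonacci-sum graph $G_n$ is the simple graph with vertex set $\{1,\dots,n\}$ in which distinct vertices $i,j$ are adjacent iff $i+j$ is a Fibonacci number. Each $G_n$ is connected and bipartite, so it has a unique proper $2$-colouring $c_n:\{1,\dots,n\}\to\{0,1\}$ with $c_n(1)=1$, and these are compatible ($c_{n'}$ restricts to $c_n$ for $n'\geq n$). Define $c(i)=c_n(i)$ for any $n\geq i$. For $N\geq 1$ let $S(N)=\sum_{i=1}^N c(i)-\tfrac{N}{2}$, and $S(0)=0$. -}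

module Defs where

open import Data.Nat using (ℕ; zero; suc; _+_; _*_; _≤_; _<_; _%_)
open import Data.Integer using (+_)
open import Data.Rational using (ℚ; _/_; _-_)
open import Data.Product using (∃)
open import Data.Sum using (_⊎_)
open import Relation.Binary.PropositionalEquality using (_≡_; _≢_)

F : ℕ → ℕ
F zero = 0
F (suc zero) = 1
F (suc (suc m)) = F (suc m) + F m

IsFib : ℕ → Set
IsFib m = ∃ λ t → F t ≡ m

-- c is "the" colouring: a map from positive integers to {0,1} with c 1 = 1
-- that is a proper colouring of the Fibonacci-sum graph on all positive
-- integers (equivalently, c restricts to the proper 2-colouring c_n of G_n
-- for every n).  Such c exists and is unique on positive integers.
record IsFibColouring (c : ℕ → ℕ) : Set where
  field
    binary : ∀ i → 1 ≤ i → c i ≡ 0 ⊎ c i ≡ 1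
    one    : c 1 ≡ 1
    proper : ∀ i j → 1 ≤ i → 1 ≤ j → i ≢ j → IsFib (i + j) → c i ≢ c j

sumC : (ℕ → ℕ) → ℕ → ℕ
sumC c zero = 0
sumC c (suc N) = sumC c N + c (suc N)

S : (ℕ → ℕ) → ℕ → ℚ
S c N = ((+ sumC c N) / 1) - ((+ N) / 2)

module Submission where

-- Write A = F(k), B = F(k-1), so F(k+1) = A + B, and let
-- N = A + d with 0 < d < B.  For 1 ≤ j < B the vertex u = B - j is
-- adjacent to j (u + j = B) and to A + j (u + A + j = F(k+1)); when u ≠ j,
-- i.e. 2j ≠ B, the proper 2-colouring forces c(A + j) = c(j).  Hence, if no
-- j ∈ [1,d] has 2j = B, the colours on (A, A + d] repeat those on [1, d] and
--   Σ_{i ≤ A+d} c(i) = Σ_{i ≤ A} c(i) + Σ_{i ≤ d} c(i),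
-- which is exactly S(A + d) = S(A) + S(d), since N/2 is additive in N.
-- The midpoint 2j = B is avoided in both cases of the theorem: if
-- k ≢ 1 (mod 3) then B = F(k-1) is odd (F(m) is even iff 3 ∣ m), and if
-- 2N < F(k+2) = 2A + B then 2d < B.
-- The file proves, in order: additivity of S, the parity of Fibonacci
-- numbers, the reflection property of the colouring and the resulting
-- splitting of the colour sums, and finally the theorem.

open import Defs
open import Data.Nat using (ℕ; _+_; _*_; _<_; _%_; _∸_)
open import Data.Sum using (_⊎_)
open import Data.Product using (_×_)
open import Data.Rational using () renaming (_+_ to _+ℚ_)
open import Relation.Binary.PropositionalEquality using (_≡_)

open import Data.Nat using (zero; suc; _≤_; z≤n; s≤s)
open import Data.Nat.Properties
open import Data.Nat.Divisibility using (divides)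
open import Data.Nat.DivMod using ([m+kn]%n≡m%n; m*n%n≡0; m∣n⇒o%n%m≡o%m)
import Data.Nat.Tactic.RingSolver as ℕ-Solver
open import Data.Integer as ℤ using (ℤ; +_)
open import Data.Integer.Properties using (pos-+; pos-*)
import Data.Integer.Tactic.RingSolver as ℤ-Solver
open import Data.Rational using (_/_; _-_; fromℚᵘ; toℚᵘ)
open import Data.Rational.Properties
  using (fromℚᵘ-toℚᵘ; toℚᵘ-fromℚᵘ; fromℚᵘ-cong; toℚᵘ-homo-+)
open import Data.Rational.Solver using (module +-*-Solver)
open import Data.Rational.Unnormalised as ℚᵘ using (mkℚᵘ; *≡*)
import Data.Rational.Unnormalised.Properties as ℚᵘ
open import Data.Sum using (inj₁; inj₂)
open import Data.Product using (_,_)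
open import Data.Empty using (⊥-elim)
open import Relation.Binary.PropositionalEquality
  using (refl; sym; trans; cong; cong₂; subst₂; _≢_; module ≡-Reasoning)

fromℚᵘ-homo-+ : ∀ p q → fromℚᵘ (p ℚᵘ.+ q) ≡ fromℚᵘ p +ℚ fromℚᵘ q
fromℚᵘ-homo-+ p q = trans (fromℚᵘ-cong p+q≃) (fromℚᵘ-toℚᵘ (fromℚᵘ p +ℚ fromℚᵘ q))
  where
  p+q≃ : (p ℚᵘ.+ q) ℚᵘ.≃ toℚᵘ (fromℚᵘ p +ℚ fromℚᵘ q)
  p+q≃ = ℚᵘ.≃-sym (ℚᵘ.≃-trans (toℚᵘ-homo-+ (fromℚᵘ p) (fromℚᵘ q))
           (ℚᵘ.+-cong (toℚᵘ-fromℚᵘ p) (toℚᵘ-fromℚᵘ q)))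

/-distrib-+ : ∀ x y d → (x ℤ.+ y) / suc d ≡ x / suc d +ℚ y / suc d
/-distrib-+ x y d = trans (fromℚᵘ-cong sum≃) (fromℚᵘ-homo-+ (mkℚᵘ x d) (mkℚᵘ y d))
  where
  distrib : ∀ x y z → (x ℤ.+ y) ℤ.* (z ℤ.* z) ≡ (x ℤ.* z ℤ.+ y ℤ.* z) ℤ.* z
  distrib = ℤ-Solver.solve-∀
  sum≃ : mkℚᵘ (x ℤ.+ y) d ℚᵘ.≃ (mkℚᵘ x d ℚᵘ.+ mkℚᵘ y d)
  sum≃ = *≡* (trans (cong ((x ℤ.+ y) ℤ.*_) (pos-* (suc d) (suc d))) (distrib x y (+ suc d)))

ℕ/-distrib-+ : ∀ a b d → + (a + b) / suc d ≡ + a / suc d +ℚ + b / suc d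
ℕ/-distrib-+ a b d = trans (cong (λ x → x / suc d) (pos-+ a b)) (/-distrib-+ (+ a) (+ b) d)

sub-+-interchange : ∀ x y u v → (x +ℚ y) - (u +ℚ v) ≡ (x - u) +ℚ (y - v)
sub-+-interchange = solve 4 (λ x y u v → (x :+ y) :- (u :+ v) := (x :- u) :+ (y :- v)) refl
  where open +-*-Solver

S-split : ∀ c p q → sumC c (p + q) ≡ sumC c p + sumC c q →
          S c (p + q) ≡ S c p +ℚ S c q
S-split c p q sum-split = begin
    + sumC c (p + q) / 1 - + (p + q) / 2
  ≡⟨ cong₂ _-_ (trans (cong (λ s → + s / 1) sum-split) (ℕ/-distrib-+ (sumC c p) (sumC c q) 0))
               (ℕ/-distrib-+ p q 1) ⟩
    (+ sumC c p / 1 +ℚ + sumC c q / 1) - (+ p / 2 +ℚ + q / 2)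
  ≡⟨ sub-+-interchange (+ sumC c p / 1) (+ sumC c q / 1) (+ p / 2) (+ q / 2) ⟩
    S c p +ℚ S c q
  ∎
  where open ≡-Reasoning

F-mono : ∀ m → F m ≤ F (suc m)
F-mono zero = z≤n
F-mono (suc zero) = s≤s z≤n
F-mono (suc (suc m)) = m≤m+n (F (suc (suc m))) (F (suc m))

F-step3 : ∀ m → F (3 + m) ≡ F m + F (suc m) * 2
F-step3 m = shape (F (suc m)) (F m)
  where
  shape : ∀ a b → (a + b) + a ≡ b + a * 2
  shape = ℕ-Solver.solve-∀

-- F(m) is odd whenever 3 ∤ m, since F(m+3) ≡ F(m) (mod 2).
F-odd : ∀ m → m % 3 ≢ 0 → F m % 2 ≡ 1
F-odd zero 3∤m = ⊥-elim (3∤m refl)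
F-odd (suc zero) _ = refl
F-odd (suc (suc zero)) _ = refl
F-odd (suc (suc (suc m))) 3∤m = begin
    F (3 + m) % 2              ≡⟨ cong (_% 2) (F-step3 m) ⟩
    (F m + F (suc m) * 2) % 2  ≡⟨ [m+kn]%n≡m%n (F m) (F (suc m)) 2 ⟩
    F m % 2                    ≡⟨ F-odd m 3∤m ⟩
    1                          ∎
  where open ≡-Reasoning

pred-mod3 : ∀ m → suc m % 3 ≢ 1 → m % 3 ≢ 0
pred-mod3 zero h = ⊥-elim (h refl)
pred-mod3 (suc zero) _ ()
pred-mod3 (suc (suc zero)) _ ()
pred-mod3 (suc (suc (suc m))) h = pred-mod3 m h

mod6⇒mod3 : ∀ k → (k % 6 ≡ 0 ⊎ k % 6 ≡ 2 ⊎ k % 6 ≡ 3 ⊎ k % 6 ≡ 5) → k % 3 ≢ 1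
mod6⇒mod3 k r k%3≡1 = residue (k % 6) r (trans (m∣n⇒o%n%m≡o%m 3 6 k (divides 2 refl)) k%3≡1)
  where
  residue : ∀ s → (s ≡ 0 ⊎ s ≡ 2 ⊎ s ≡ 3 ⊎ s ≡ 5) → s % 3 ≢ 1
  residue .0 (inj₁ refl) ()
  residue .2 (inj₂ (inj₁ refl)) ()
  residue .3 (inj₂ (inj₂ (inj₁ refl))) ()
  residue .5 (inj₂ (inj₂ (inj₂ refl))) ()

HalfAvoids : ℕ → ℕ → Set
HalfAvoids m d = ∀ j → 1 ≤ j → j ≤ d → 2 * j ≢ F m

odd⇒HalfAvoids : ∀ m d → F m % 2 ≡ 1 → HalfAvoids m d
odd⇒HalfAvoids m d odd j _ _ 2j≡F = 0≢1+n (begin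
    0            ≡⟨ sym (m*n%n≡0 j 2) ⟩
    (j * 2) % 2  ≡⟨ cong (_% 2) (trans (*-comm j 2) 2j≡F) ⟩
    F m % 2      ≡⟨ odd ⟩
    1            ∎)
  where open ≡-Reasoning

small⇒HalfAvoids : ∀ m d → 2 * d < F m → HalfAvoids m d
small⇒HalfAvoids m d 2d<F j _ j≤d = <⇒≢ (≤-<-trans (*-monoʳ-≤ 2 j≤d) 2d<F)

differ-twice⇒equal : ∀ {x y z : ℕ} → (x ≡ 0 ⊎ x ≡ 1) → (y ≡ 0 ⊎ y ≡ 1) → (z ≡ 0 ⊎ z ≡ 1) →
                     x ≢ y → y ≢ z → x ≡ z
differ-twice⇒equal (inj₁ refl) (inj₁ refl) _ x≢y _ = ⊥-elim (x≢y refl)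
differ-twice⇒equal (inj₂ refl) (inj₂ refl) _ x≢y _ = ⊥-elim (x≢y refl)
differ-twice⇒equal _ (inj₁ refl) (inj₁ refl) _ y≢z = ⊥-elim (y≢z refl)
differ-twice⇒equal _ (inj₂ refl) (inj₂ refl) _ y≢z = ⊥-elim (y≢z refl)
differ-twice⇒equal (inj₁ refl) (inj₂ refl) (inj₁ refl) _ _ = refl
differ-twice⇒equal (inj₂ refl) (inj₁ refl) (inj₂ refl) _ _ = refl

module _ (c : ℕ → ℕ) (hc : IsFibColouring c) where
  open IsFibColouring hc

  -- Reflection: u = F m - j is a common neighbour of j and F(m+1) + j,
  -- so these two get the same colour unless u = j.
  reflect : ∀ m j → 1 ≤ j → j < F m → 2 * j ≢ F m → c (F (suc m) + j) ≡ c j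
  reflect m j 1≤j j<B 2j≢B =
    differ-twice⇒equal (binary i 1≤i) (binary u 1≤u) (binary j 1≤j)
      (proper i u 1≤i 1≤u (>⇒≢ u<i) i+u-fib) (proper u j 1≤u 1≤j u≢j u+j-fib)
    where
    A B i u : ℕ
    A = F (suc m)
    B = F m
    i = A + j
    u = B ∸ j
    j≤B : j ≤ B
    j≤B = <⇒≤ j<B
    1≤i : 1 ≤ i
    1≤i = ≤-trans 1≤j (m≤n+m j A)
    1≤u : 1 ≤ u
    1≤u = m<n⇒0<n∸m j<B
    u<i : u < i
    u<i = ≤-<-trans (≤-trans (m∸n≤m B j) (F-mono m)) (m<m+n A 1≤j)
    i+u-fib : IsFib (i + u)
    i+u-fib = suc (suc m) , sym (trans (+-assoc A j u) (cong (_+_ A) (m+[n∸m]≡n j≤B)))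
    u+j-fib : IsFib (u + j)
    u+j-fib = m , sym (m∸n+n≡m j≤B)
    u≢j : u ≢ j
    u≢j u≡j = 2j≢B (trans (cong (_+_ j) (trans (+-identityʳ j) (sym u≡j))) (m+[n∸m]≡n j≤B))

  sum-split : ∀ m d → d < F m → HalfAvoids m d →
              sumC c (F (suc m) + d) ≡ sumC c (F (suc m)) + sumC c d
  sum-split m zero _ _ = trans (cong (sumC c) (+-identityʳ (F (suc m)))) (sym (+-identityʳ _))
  sum-split m (suc d) d<B avoids = begin
      sumC c (A + suc d)
    ≡⟨ cong (sumC c) (+-suc A d) ⟩
      sumC c (A + d) + c (suc (A + d))
    ≡⟨ cong₂ _+_ (sum-split m d (<-trans (n<1+n d) d<B) avoids-below)
                 (trans (cong c (sym (+-suc A d))) reflect-last) ⟩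
      (sumC c A + sumC c d) + c (suc d)
    ≡⟨ +-assoc (sumC c A) (sumC c d) (c (suc d)) ⟩
      sumC c A + sumC c (suc d)
    ∎
    where
    A : ℕ
    A = F (suc m)
    open ≡-Reasoning
    avoids-below : HalfAvoids m d
    avoids-below j 1≤j j≤d = avoids j 1≤j (m≤n⇒m≤1+n j≤d)
    reflect-last : c (A + suc d) ≡ c (suc d)
    reflect-last = reflect m (suc d) (s≤s z≤n) d<B (avoids (suc d) (s≤s z≤n) ≤-refl)

-- With N = A + d and F(k+2) = (A + B) + A, the bound 2N < F(k+2) means 2d < B.
halve-bound : ∀ A B d → 2 * (A + d) < (A + B) + A → 2 * d < B
halve-bound A B d h = +-cancelʳ-< (A + A) (2 * d) B (subst₂ _<_ (lhs A d) (rhs A B) h)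
  where
  lhs : ∀ A d → 2 * (A + d) ≡ 2 * d + (A + A)
  lhs = ℕ-Solver.solve-∀
  rhs : ∀ A B → (A + B) + A ≡ B + (A + A)
  rhs = ℕ-Solver.solve-∀

lemma7 : (c : ℕ → ℕ) → IsFibColouring c → (N k : ℕ) →
    F k < N → N < F (k + 1) →
    ((k % 6 ≡ 0 ⊎ k % 6 ≡ 2 ⊎ k % 6 ≡ 3 ⊎ k % 6 ≡ 5)
    ⊎ ((k % 6 ≡ 1 ⊎ k % 6 ≡ 4) × 2 * N < F (k + 2))) →
    S c N ≡ S c (F k) +ℚ S c (N ∸ F k)
-- k = 0 is impossible (0 < N < 1); for k = m + 1, A = F k and B = F m.
lemma7 c hc N zero (s≤s _) (s≤s ()) _
lemma7 c hc N (suc m) A<N N<F cond = begin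
    S c N                ≡⟨ cong (S c) (sym A+d≡N) ⟩
    S c (A + d)          ≡⟨ S-split c A d (sum-split c hc m d d<B (avoids cond)) ⟩
    S c A +ℚ S c d       ∎
  where
  open ≡-Reasoning
  A d : ℕ
  A = F (suc m)
  d = N ∸ A
  A+d≡N : A + d ≡ N
  A+d≡N = m+[n∸m]≡n (<⇒≤ A<N)
  d<B : d < F m
  d<B = +-cancelˡ-< A d (F m)
          (subst₂ _<_ (sym A+d≡N) (cong F (+-comm (suc m) 1)) N<F)
  avoids : (suc m % 6 ≡ 0 ⊎ suc m % 6 ≡ 2 ⊎ suc m % 6 ≡ 3 ⊎ suc m % 6 ≡ 5)
           ⊎ ((suc m % 6 ≡ 1 ⊎ suc m % 6 ≡ 4) × 2 * N < F (suc m + 2)) →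
           HalfAvoids m d
  avoids (inj₁ r) = odd⇒HalfAvoids m d (F-odd m (pred-mod3 m (mod6⇒mod3 (suc m) r)))
  avoids (inj₂ (_ , 2N<F)) = small⇒HalfAvoids m d (halve-bound A (F m) d
    (subst₂ (λ n f → 2 * n < f) (sym A+d≡N) (cong F (+-comm (suc m) 2)) 2N<F))
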